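{- Consider the following two families of triples of linear polynomials in $n$. (i) For integers $\alpha\ge2$, $\beta\ge1$: $p(n)=2^\alpha3^\beta n-1$, $q(n)=n$, $r(n)=2^{\alpha-1}3^\beta n-1$. (ii) For integers $\beta\ge1$, $\gamma\ge2$, with $k$ the unique integer with $0<k<3^\beta2^\gamma$, $k\equiv-1\pmod{3^\beta}$, $k\equiv 1\pmod{2^\gamma}$: $p(n)=3^\beta2^\gamma n+k$, $q(n)=2^{\gamma-1}n+\frac{k+1}{2\cdot3^\beta}$, $r(n)=3^\beta n+\frac{k-1}{2^\gamma}$. In both cases, each of $p(n),q(n),r(n)$ is an irreducible primitive polynomial, i.e. of the form $an+b$ with $a,b\in\mathbb{Z}$ and $\gcd(a,b)=1$; and for every odd prime $\ell$ there is no $n\in\mathbb{N}_0$ such that more than one of $p(n),q(n),r(n)$ is divisible by $\ell$. -}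

module Defs where

open import Data.Nat as ℕ using (ℕ; NonZero; _∸_; _^_)
open import Data.Nat.Properties using (m*n≢0; m^n≢0)
open import Data.Nat.Primality using (Prime)
open import Data.Integer as ℤ using (ℤ; +_; -[1+_]; 0ℤ; 1ℤ)
open import Data.Integer.Divisibility using (_∣_)
open import Data.Integer.GCD using (gcd)
open import Data.Product using (_×_; _,_)
open import Relation.Binary.PropositionalEquality using (_≡_; _≢_)
open import Relation.Nullary using (¬_)

record LinPoly : Set where
  constructor _·n+_
  field
    a : ℤ
    b : ℤ
open LinPoly public

eval : LinPoly → ℕ → ℤ
eval P n = a P ℤ.* + n ℤ.+ b P

-- "irreducible primitive": of the form a n + b (degree one, a ≠ 0) with gcd(a,b) = 1.
IrreduciblePrimitive : LinPoly → Set
IrreduciblePrimitive P = (a P ≢ 0ℤ) × (gcd (a P) (b P) ≡ 1ℤ)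

AtMostOneDivisible : LinPoly → LinPoly → LinPoly → Set
AtMostOneDivisible p q r =
  ∀ (ℓ : ℕ) → Prime ℓ → ℓ ≢ 2 → ∀ (n : ℕ) →
    ¬ ((+ ℓ ∣ eval p n) × (+ ℓ ∣ eval q n)) ×
    ¬ ((+ ℓ ∣ eval p n) × (+ ℓ ∣ eval r n)) ×
    ¬ ((+ ℓ ∣ eval q n) × (+ ℓ ∣ eval r n))

GoodTriple : LinPoly → LinPoly → LinPoly → Set
GoodTriple p q r =
  (IrreduciblePrimitive p × IrreduciblePrimitive q × IrreduciblePrimitive r) ×
  AtMostOneDivisible p q r

famI-p famI-q famI-r : ℕ → ℕ → LinPoly
famI-p α β = (+ (2 ^ α ℕ.* 3 ^ β)) ·n+ -[1+ 0 ]
famI-q α β = 1ℤ ·n+ 0ℤ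
famI-r α β = (+ (2 ^ (α ∸ 1) ℕ.* 3 ^ β)) ·n+ -[1+ 0 ]

-- Exact divisions (k+1)/(2·3^β) and (k−1)/2^γ (exact under the hypotheses on k).
divBy2·3^β : ℕ → ℕ → ℕ
divBy2·3^β β m = ℕ._/_ m (2 ℕ.* 3 ^ β) {{m*n≢0 2 (3 ^ β) {{_}} {{m^n≢0 3 β}}}}

divBy2^γ : ℕ → ℕ → ℕ
divBy2^γ γ m = ℕ._/_ m (2 ^ γ) {{m^n≢0 2 γ}}

famII-p famII-q famII-r : ℕ → ℕ → ℕ → LinPoly
famII-p β γ k = (+ (3 ^ β ℕ.* 2 ^ γ)) ·n+ (+ k)
famII-q β γ k = (+ (2 ^ (γ ∸ 1))) ·n+ (+ divBy2·3^β β (ℕ.suc k))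
famII-r β γ k = (+ (3 ^ β)) ·n+ (+ divBy2^γ γ (k ∸ 1))

{-# OPTIONS --safe #-}
-- Both families have the shape  p = 2tg·n + k,  q = g·n + κ,  r = t·n + ρ  with
-- k = 1 + 2gρ and 2tκ = k + 1, i.e. tκ − gρ = 1: family (i) is t = 2^(α−1)3^β, g = 1,
-- κ = 0, ρ = −1, and family (ii) is t = 3^β, g = 2^(γ−1), κ = (k+1)/(2·3^β), ρ = (k−1)/2^γ.
-- Then −p + 2t·q = 1, p − 2g·r = 1 and t·q − g·r = 1 identically in n, so any two of
-- p(n), q(n), r(n) are coprime: no prime at all, odd or not, divides two of them.
-- Primitivity likewise follows from Bézout identities among the coefficients.
module Submission where

open import Defs
open import Data.Empty using (⊥-elim)
open import Data.List using (_∷_; [])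
open import Data.Product using (_×_; _,_)
open import Data.Sum using (inj₁; inj₂)
open import Relation.Binary.PropositionalEquality using (_≡_; _≢_; refl; sym; trans; cong; subst; module ≡-Reasoning)
open import Relation.Nullary using (¬_)
open import Data.Nat.Primality using (Prime; ¬prime[1]; prime[2]; euclidsLemma)
import Data.Integer as ℤ

-- A local module, since the integer operators clash with the natural-number ones of the statement.
module _ where
  open import Data.Integer using (ℤ; +_; -_; _+_; _-_; _*_; 0ℤ; 1ℤ)
  open import Data.Integer.Properties using (i*j≡0⇒i≡0∨j≡0; *-cancelˡ-≡)
  open import Data.Integer.Divisibility using (_∣_)
  open import Data.Integer.Divisibility.Signed using (∣ᵤ⇒∣; ∣⇒∣ᵤ; ∣m∣n⇒∣m+n; ∣n⇒∣m*n)
  open import Data.Integer.GCD using (gcd; gcd[i,j]∣i; gcd[i,j]∣j)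
  open import Data.Integer.Tactic.RingSolver using (solve)
  open import Data.Nat.Divisibility using (∣1⇒≡1)
  open ≡-Reasoning

  *-≢0 : ∀ {i j} → i ≢ 0ℤ → j ≢ 0ℤ → i * j ≢ 0ℤ
  *-≢0 {i} i≢0 j≢0 ij≡0 with i*j≡0⇒i≡0∨j≡0 i ij≡0
  ... | inj₁ i≡0 = i≢0 i≡0
  ... | inj₂ j≡0 = j≢0 j≡0

  ≡-modulo : ∀ {x y d e} → d ≡ e → ∀ c → x ≡ y + c * (d - e) → x ≡ y
  ≡-modulo {y = y} {e = e} refl c x≡y+c[e-e] = trans x≡y+c[e-e] (solve (y ∷ c ∷ e ∷ []))

  ∣-linear : ∀ {d} u x v y → d ∣ x → d ∣ y → d ∣ u * x + v * y
  ∣-linear {d} u x v y d∣x d∣y = ∣⇒∣ᵤ {d} {u * x + v * y}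
    (∣m∣n⇒∣m+n (∣n⇒∣m*n u (∣ᵤ⇒∣ {d} {x} d∣x)) (∣n⇒∣m*n v (∣ᵤ⇒∣ {d} {y} d∣y)))

  bézout⇒gcd≡1 : ∀ i j u v → u * i + v * j ≡ 1ℤ → gcd i j ≡ 1ℤ
  bézout⇒gcd≡1 i j u v bézout = cong +_ (∣1⇒≡1 (subst (gcd i j ∣_) bézout
    (∣-linear {gcd i j} u i v j (gcd[i,j]∣i i j) (gcd[i,j]∣j i j))))

  record CoprimeValues (P Q : LinPoly) : Set where
    constructor coprimeValuesAt
    field
      coprimeAt : ∀ n d → d ∣ eval P n → d ∣ eval Q n → d ∣ 1ℤ

  combination⇒coprimeValues : ∀ {α β γ δ} u v → u * α + v * γ ≡ 0ℤ → u * β + v * δ ≡ 1ℤ →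
                              CoprimeValues (α ·n+ β) (γ ·n+ δ)
  combination⇒coprimeValues {α} {β} {γ} {δ} u v leading constant =
    coprimeValuesAt λ n d d∣P d∣Q → subst (d ∣_) (combination (+ n)) (∣-linear {d} u (α * + n + β) v (γ * + n + δ) d∣P d∣Q)
    where
    combination : ∀ m → u * (α * m + β) + v * (γ * m + δ) ≡ 1ℤ
    combination m = begin
      u * (α * m + β) + v * (γ * m + δ)    ≡⟨ solve (u ∷ v ∷ α ∷ β ∷ γ ∷ δ ∷ m ∷ []) ⟩
      (u * α + v * γ) * m + (u * β + v * δ) ≡⟨ cong (λ c → c * m + (u * β + v * δ)) leading ⟩
      0ℤ * m + (u * β + v * δ)              ≡⟨ cong (λ c → 0ℤ * m + c) constant ⟩
      1ℤ                                    ∎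

  atMostOneDivisible : ∀ {p q r} → CoprimeValues p q → CoprimeValues p r → CoprimeValues q r →
                       AtMostOneDivisible p q r
  atMostOneDivisible pq pr qr ℓ ℓ-prime _ n =
    noCommonFactor pq , noCommonFactor pr , noCommonFactor qr
    where
    noCommonFactor : ∀ {P Q} → CoprimeValues P Q → ¬ (+ ℓ ∣ eval P n × + ℓ ∣ eval Q n)
    noCommonFactor PQ (ℓ∣P , ℓ∣Q) =
      ¬prime[1] (subst Prime (∣1⇒≡1 (CoprimeValues.coprimeAt PQ n (+ ℓ) ℓ∣P ℓ∣Q)) ℓ-prime)

  goodTriple-2tgn+k : ∀ {a k} t g κ ρ → t ≢ 0ℤ → g ≢ 0ℤ →
    a ≡ t * (+ 2 * g) → k ≡ 1ℤ + ρ * (+ 2 * g) → κ * (+ 2 * t) ≡ 1ℤ + k →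
    GoodTriple (a ·n+ k) (g ·n+ κ) (t ·n+ ρ)
  goodTriple-2tgn+k t g κ ρ t≢0 g≢0 refl refl κ2t≡1+k =
    (irreducible-p , irreducible-q , irreducible-r) ,
    atMostOneDivisible coprime-pq coprime-pr coprime-qr
    where
    p = (t * (+ 2 * g)) ·n+ (1ℤ + ρ * (+ 2 * g))
    q = g ·n+ κ
    r = t ·n+ ρ

    tκ≡1+gρ : t * κ ≡ 1ℤ + g * ρ
    tκ≡1+gρ = *-cancelˡ-≡ (+ 2) (t * κ) (1ℤ + g * ρ) (begin
      + 2 * (t * κ)             ≡⟨ solve (t ∷ κ ∷ []) ⟩
      κ * (+ 2 * t)             ≡⟨ κ2t≡1+k ⟩
      1ℤ + (1ℤ + ρ * (+ 2 * g)) ≡⟨ solve (g ∷ ρ ∷ []) ⟩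
      + 2 * (1ℤ + g * ρ)        ∎)

    -- k² − (k − 1)(k + 1) = 1, where (k − 1)(k + 1) = 2gρ·2tκ is a multiple of the leading coefficient.
    irreducible-p : IrreduciblePrimitive p
    irreducible-p = *-≢0 t≢0 (*-≢0 {+ 2} (λ ()) g≢0) ,
      bézout⇒gcd≡1 (t * (+ 2 * g)) (1ℤ + ρ * (+ 2 * g)) (- (+ 2 * ρ * κ)) (1ℤ + ρ * (+ 2 * g))
      (≡-modulo tκ≡1+gρ (- (+ 4 * g * ρ)) (solve (t ∷ g ∷ κ ∷ ρ ∷ [])))

    irreducible-q : IrreduciblePrimitive q
    irreducible-q = g≢0 , bézout⇒gcd≡1 g κ (- ρ) t (≡-modulo tκ≡1+gρ 1ℤ (solve (t ∷ g ∷ κ ∷ ρ ∷ [])))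

    irreducible-r : IrreduciblePrimitive r
    irreducible-r = t≢0 , bézout⇒gcd≡1 t ρ κ (- g) (≡-modulo tκ≡1+gρ 1ℤ (solve (t ∷ g ∷ κ ∷ ρ ∷ [])))

    coprime-pq : CoprimeValues p q
    coprime-pq = combination⇒coprimeValues (- 1ℤ) (+ 2 * t) (solve (t ∷ g ∷ []))
      (≡-modulo tκ≡1+gρ (+ 2) (solve (t ∷ g ∷ κ ∷ ρ ∷ [])))

    coprime-pr : CoprimeValues p r
    coprime-pr = combination⇒coprimeValues 1ℤ (- (+ 2 * g)) (solve (t ∷ g ∷ [])) (solve (g ∷ ρ ∷ []))

    coprime-qr : CoprimeValues q r
    coprime-qr = combination⇒coprimeValues t (- g) (solve (t ∷ g ∷ []))
      (≡-modulo tκ≡1+gρ 1ℤ (solve (t ∷ g ∷ κ ∷ ρ ∷ [])))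

open import Data.Nat using (ℕ; _≤_; _<_; _*_; _^_; _∸_; suc)
open import Data.Nat.Divisibility using (_∣_)
open import Data.Nat using (zero; NonZero; ≢-nonZero⁻¹)
open import Data.Nat.Properties using (*-assoc; *-comm; m^n≢0; m*n≢0; <⇒≤)
open import Data.Nat.Divisibility using (divides; ∣1⇒≡1; ∣-refl; ∣-trans; m∣m*n; ∣m∣n⇒∣m+n; _∣?_)
open import Data.Nat.DivMod using (m/n*n≡m)
open import Data.Integer using (+_; 0ℤ; 1ℤ; -[1+_])
open import Data.Integer.Properties using (pos-*; +-injective)
open import Relation.Nullary.Decidable using (from-no)

∤⇒∤^ : ∀ {p m} → Prime p → ¬ p ∣ m → ∀ n → ¬ p ∣ m ^ n
∤⇒∤^ p-prime p∤m zero    p∣1 = ¬prime[1] (subst Prime (∣1⇒≡1 p∣1) p-prime)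
∤⇒∤^ {m = m} p-prime p∤m (suc n) p∣m^[1+n] with euclidsLemma m (m ^ n) p-prime p∣m^[1+n]
... | inj₁ p∣m   = p∤m p∣m
... | inj₂ p∣m^n = ∤⇒∤^ p-prime p∤m n p∣m^n

prime∤∧∣⇒*∣ : ∀ {p m n} → Prime p → ¬ p ∣ m → p ∣ n → m ∣ n → p * m ∣ n
prime∤∧∣⇒*∣ {p} {m} {n} p-prime p∤m p∣n (divides c n≡c*m)
  with euclidsLemma c m p-prime (subst (p ∣_) n≡c*m p∣n)
... | inj₂ p∣m               = ⊥-elim (p∤m p∣m)
... | inj₁ (divides e c≡e*p) = divides e (begin
  n           ≡⟨ n≡c*m ⟩
  c * m       ≡⟨ cong (_* m) c≡e*p ⟩
  e * p * m   ≡⟨ *-assoc e p m ⟩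
  e * (p * m) ∎)
  where open ≡-Reasoning

pos≢0 : ∀ m → .{{NonZero m}} → + m ≢ 0ℤ
pos≢0 m +m≡0 = ≢-nonZero⁻¹ m (+-injective +m≡0)

pos-*-double : ∀ x y → + (x * (2 * y)) ≡ + x ℤ.* (+ 2 ℤ.* + y)
pos-*-double x y = trans (pos-* x (2 * y)) (cong (+ x ℤ.*_) (pos-* 2 y))

familyI : ∀ α β → 1 ≤ α → GoodTriple (famI-p α β) (famI-q α β) (famI-r α β)
familyI (suc α) β _ =
  goodTriple-2tgn+k (+ B) 1ℤ 0ℤ -[1+ 0 ] (pos≢0 B) (λ ()) leading refl refl
  where
  B = 2 ^ α * 3 ^ β
  instance
    B≢0 : NonZero B
    B≢0 = m*n≢0 (2 ^ α) (3 ^ β) {{m^n≢0 2 α}} {{m^n≢0 3 β}}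
  leading : + (2 ^ suc α * 3 ^ β) ≡ + B ℤ.* (+ 2 ℤ.* 1ℤ)
  leading = trans (cong +_ (trans (*-assoc 2 (2 ^ α) (3 ^ β)) (*-comm 2 B))) (pos-* B 2)

familyII : ∀ β γ k → 1 ≤ γ → 0 < k → 3 ^ β ∣ suc k → 2 ^ γ ∣ k ∸ 1 →
           GoodTriple (famII-p β γ k) (famII-q β γ k) (famII-r β γ k)
familyII β (suc γ) (suc m) _ _ 3^β∣m+2 2^γ∣m =
  goodTriple-2tgn+k (+ T) (+ G) (+ Q) (+ R) (pos≢0 T) (pos≢0 G)
    (pos-*-double T G)
    (cong (λ i → 1ℤ ℤ.+ i) (trans (cong +_ (sym (m/n*n≡m 2^γ∣m))) (pos-*-double R G)))
    (trans (sym (pos-*-double Q T)) (cong +_ (m/n*n≡m 2*3^β∣m+2)))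
  where
  T = 3 ^ β
  G = 2 ^ γ
  instance
    T≢0 : NonZero T
    T≢0 = m^n≢0 3 β
    G≢0 : NonZero G
    G≢0 = m^n≢0 2 γ
    2G≢0 : NonZero (2 ^ suc γ)
    2G≢0 = m^n≢0 2 (suc γ)
    2T≢0 : NonZero (2 * T)
    2T≢0 = m*n≢0 2 T
  R = divBy2^γ (suc γ) m
  Q = divBy2·3^β β (suc (suc m))
  2*3^β∣m+2 : 2 * T ∣ suc (suc m)
  2*3^β∣m+2 = prime∤∧∣⇒*∣ prime[2] (∤⇒∤^ prime[2] (from-no (2 ∣? 3)) β)
    (∣m∣n⇒∣m+n ∣-refl (∣-trans (m∣m*n G) 2^γ∣m)) 3^β∣m+2

lemma3p5 :
    (∀ (α β : ℕ) → 2 ≤ α → 1 ≤ β →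
      GoodTriple (famI-p α β) (famI-q α β) (famI-r α β))
    ×
    (∀ (β γ k : ℕ) → 1 ≤ β → 2 ≤ γ →
      0 < k → k < 3 ^ β * 2 ^ γ →
      3 ^ β ∣ suc k →
      2 ^ γ ∣ k ∸ 1 →
      GoodTriple (famII-p β γ k) (famII-q β γ k) (famII-r β γ k))
lemma3p5 =
  (λ α β 2≤α _ → familyI α β (<⇒≤ 2≤α)) ,
  (λ β γ k _ 2≤γ 0<k _ → familyII β γ k (<⇒≤ 2≤γ) 0<k)
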